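{- Let $L$ be a finite supersolvable semimodular lattice with a fixed maximal chain $\hat0=x_0\lessdot x_1\lessdot\cdots\lessdot x_n=\hat1$ of modular elements. Define $\nu:L\to\mathbb{N}$ by $\nu(x)=\min\{i: x\le x_i\}$ and, for an integer $k\ge1$, let $L^{(k)}=\{x\in L:\ \nu(x)-\rho(x)<k\}$ with the induced partial order. Then for every $k\ge1$, $L^{(k)}$ is a supersolvable semimodular lattice, and $x_0\lessdot x_1\lessdot\cdots\lessdot x_n$ is a maximal chain of modular elements of $L^{(k)}$.
   Context: A finite lattice is semimodular if it is graded with rank function $\rho$ and $\rho(p)+\rho(q)\ge\rho(p\vee q)+\rho(p\wedge q)$ for all $p,q$. An element $p$ of a semimodular lattice is modular if $\rho(p)+\rho(q)=\rho(p\vee q)+\rho(p\wedge q)$ for all $q$. A semimodular lattice is supersolvable if it has a maximal chain consisting of modular elements. -}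

module Defs where

open import Level using (0ℓ)
open import Data.Nat as ℕ using (ℕ; suc; _+_)
open import Data.Fin using (Fin; zero; suc; toℕ; fromℕ; inject₁)
open import Data.Product using (Σ; ∃; _×_; _,_; proj₁)
open import Data.Sum using (_⊎_)
open import Relation.Nullary using (¬_)
open import Relation.Binary.Core using (Rel)
open import Relation.Binary.Structures using (IsPartialOrder)
open import Relation.Binary.PropositionalEquality using (_≡_)

module _ {A : Set} (_≈_ : Rel A 0ℓ) (_⊑_ : Rel A 0ℓ) where

  Covers : A → A → Set
  Covers x y = (x ⊑ y) × (¬ (x ≈ y)) × (∀ z → x ⊑ z → z ⊑ y → (z ≈ x) ⊎ (z ≈ y))

  IsJoin : A → A → A → Set
  IsJoin x y j = (x ⊑ j) × (y ⊑ j) × (∀ z → x ⊑ z → y ⊑ z → j ⊑ z)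

  IsMeet : A → A → A → Set
  IsMeet x y m = (m ⊑ x) × (m ⊑ y) × (∀ z → z ⊑ x → z ⊑ y → z ⊑ m)

  record IsSemimodularLattice : Set where
    field
      isPartialOrder : IsPartialOrder _≈_ _⊑_
      _∨_ : A → A → A
      _∧_ : A → A → A
      ∨-isJoin : ∀ x y → IsJoin x y (x ∨ y)
      ∧-isMeet : ∀ x y → IsMeet x y (x ∧ y)
      bot : A
      bot-least : ∀ x → bot ⊑ x
      ρ : A → ℕ
      ρ-resp : ∀ x y → x ≈ y → ρ x ≡ ρ y
      ρ-bot : ρ bot ≡ 0
      ρ-cover : ∀ x y → Covers x y → ρ y ≡ suc (ρ x)
      semimodular : ∀ p q → ρ (p ∨ q) + ρ (p ∧ q) ℕ.≤ ρ p + ρ q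

  IsModular : IsSemimodularLattice → A → Set
  IsModular L p = ∀ q → ρ p + ρ q ≡ ρ (p ∨ q) + ρ (p ∧ q)
    where open IsSemimodularLattice L

  IsMaximalChain : (n : ℕ) → (Fin (suc n) → A) → Set
  IsMaximalChain n x =
    (∀ z → x zero ⊑ z) × (∀ z → z ⊑ x (fromℕ n)) ×
    (∀ (i : Fin n) → Covers (x (inject₁ i)) (x (suc i)))

  IsSupersolvable : IsSemimodularLattice → Set
  IsSupersolvable L = Σ ℕ λ n → Σ (Fin (suc n) → A) λ x →
    IsMaximalChain n x × (∀ i → IsModular L (x i))

-- The induced order on a subset {a | P a}; elements of the subset are
-- identified when their underlying elements are equal (membership proofs ignored)
Induced : {A : Set} (P : A → Set) → Rel A 0ℓ → Rel (Σ A P) 0ℓ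
Induced P _⊑_ a b = proj₁ a ⊑ proj₁ b

SubEq : {A : Set} (P : A → Set) → Rel (Σ A P) 0ℓ
SubEq P a b = proj₁ a ≡ proj₁ b

IsNu : {m n : ℕ} (_⊑_ : Rel (Fin m) 0ℓ) (x : Fin (suc n) → Fin m) →
       Fin m → Fin (suc n) → Set
IsNu _⊑_ x y i = (y ⊑ x i) × (∀ j → y ⊑ x j → toℕ i ℕ.≤ toℕ j)

-- membership in L^(k):  ν(y) - ρ(y) < k   (as integers, i.e. ν(y) < k + ρ(y))
InLk : {m n : ℕ} (_⊑_ : Rel (Fin m) 0ℓ) (L : IsSemimodularLattice _≡_ _⊑_)
       (x : Fin (suc n) → Fin m) (k : ℕ) → Fin m → Set
InLk _⊑_ L x k y =
  ∃ λ i → IsNu _⊑_ x y i × (toℕ i ℕ.< k + IsSemimodularLattice.ρ L y)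

{-# OPTIONS --safe #-}
module Submission where

-- L⁽ᵏ⁾ contains 0̂ and every xᵢ and is closed under joins, since ν (y ∨ z) ≤ max (ν y) (ν z)
-- while ρ only grows.  Being finite, it is a lattice whose meet lies below the meet of L, so
-- semimodularity is inherited.  For q ∈ L⁽ᵏ⁾ modularity of xᵢ bounds ν − ρ at xᵢ ∧ q by its
-- value at q, so xᵢ ∧ q ∈ L⁽ᵏ⁾ and the rank identity of xᵢ is inherited as well.  The rank
-- stays a grading: if y ⋖ z in L⁽ᵏ⁾, pick i with xᵢ ∧ z ⊑ y but xᵢ₊₁ ∧ z ⋢ y (it exists as
-- x₀ ∧ z = 0̂ and xₙ ∧ z = z).  Modularity of xᵢ ⋖ xᵢ₊₁ gives ρ (xᵢ₊₁ ∧ z) ≤ ρ (xᵢ ∧ z) + 1, so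
-- by semimodularity y ∨ (xᵢ₊₁ ∧ z) covers y in L; it lies in L⁽ᵏ⁾ and below z, hence equals z.

open import Defs
open import Level using (0ℓ)
open import Data.Nat using (ℕ; suc; _≤_)
open import Data.Fin using (Fin)
open import Data.Product using (Σ; _×_; _,_)
open import Relation.Binary.Core using (Rel)
open import Relation.Binary.PropositionalEquality using (_≡_)

open import Data.Empty using (⊥-elim)
open import Data.Fin using (zero; suc; toℕ; fromℕ; inject₁)
open import Data.Fin.Induction
  using (<-weakInduction; <-weakInduction-startingFrom; po-wellFounded; po-noetherian)
open import Data.Fin.Properties using (any?; toℕ-inject₁) renaming (_≟_ to _≟ᶠ_)
open import Data.Nat using (zero; _+_; _<_; z≤n; s≤s; _≤?_; _<?_)
open import Data.Nat.Properties
  using (≤-refl; ≤-reflexive; ≤-trans; ≤-antisym; ≤-total; <-trans; <⇒≤; ≰⇒>; ≤-<-trans;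
         <-≤-trans; m≤m+n; +-suc; +-monoˡ-≤; +-monoʳ-≤; +-monoˡ-<; +-cancelˡ-≤; +-cancelʳ-≤;
         +-cancelʳ-<; +-commutativeSemigroup; module ≤-Reasoning)
open import Algebra.Properties.CommutativeSemigroup +-commutativeSemigroup using (xy∙z≈xz∙y)
open import Data.Product using (∃; proj₁; proj₂)
open import Data.Sum using (_⊎_; inj₁; inj₂)
open import Function using (_∘_; flip)
open import Induction.WellFounded using (Acc; acc)
open import Relation.Binary.Definitions using (Decidable)
open import Relation.Binary.PropositionalEquality using (_≢_; refl; sym; trans; cong; subst; subst₂)
open import Relation.Binary.Structures using (IsPartialOrder; IsDecPartialOrder)
open import Relation.Nullary using (¬_; Dec; yes; no)
open import Relation.Nullary.Decidable using (map′; _×-dec_)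
import Relation.Binary.Construct.On as On
import Relation.Binary.Construct.NonStrictToStrict as ToStrict

∃-least : ∀ {n} {P : Fin n → Set} → (∀ i → Dec (P i)) → ∀ {i} → P i →
          ∃ λ j → P j × (∀ j′ → P j′ → toℕ j ≤ toℕ j′)
∃-least {suc n} P? {i} Pi with P? zero | i
... | yes P0 | _ = zero , P0 , λ _ _ → z≤n
... | no ¬P0 | zero = ⊥-elim (¬P0 Pi)
... | no ¬P0 | suc _ =
  let j , Pj , j-least = ∃-least (P? ∘ suc) Pi in
  suc j , Pj , λ { zero P0 → ⊥-elim (¬P0 P0) ; (suc j′) Pj′ → s≤s (j-least j′ Pj′) }

crossing : ∀ {n} {P : Fin (suc n) → Set} → (∀ i → Dec (P i)) → P zero → ¬ P (fromℕ n) →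
           ∃ λ (i : Fin n) → P (inject₁ i) × ¬ P (suc i)
crossing {zero} P? P0 ¬Pn = ⊥-elim (¬Pn P0)
crossing {suc n} P? P0 ¬Pn with P? (suc zero)
... | no ¬P1 = zero , P0 , ¬P1
... | yes P1 = let i , Pi , ¬Pi+1 = crossing (P? ∘ suc) P1 ¬Pn in suc i , Pi , ¬Pi+1

≤inject₁⊎suc≤ : ∀ {n} j (i : Fin n) → j ≤ toℕ (inject₁ i) ⊎ suc (toℕ i) ≤ j
≤inject₁⊎suc≤ j i with j ≤? toℕ i
... | yes j≤i = inj₁ (subst (j ≤_) (sym (toℕ-inject₁ i)) j≤i)
... | no j≰i = inj₂ (≰⇒> j≰i)

module FiniteGradedPoset {m : ℕ} {_⊑_ : Rel (Fin m) 0ℓ} (isDPO : IsDecPartialOrder _≡_ _⊑_)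
  (ρ : Fin m → ℕ) (ρ-cover : ∀ a b → Covers _≡_ _⊑_ a b → ρ b ≡ suc (ρ a)) where

  open IsDecPartialOrder isDPO using (isPartialOrder; _≟_)
    renaming (_≤?_ to _⊑?_; refl to ⊑-refl; trans to ⊑-trans)
  open ToStrict _≡_ _⊑_ using (<-decidable) renaming (_<_ to _⊏_)

  cover⊎between : ∀ {a b} → a ⊏ b → Covers _≡_ _⊑_ a b ⊎ ∃ λ c → a ⊏ c × c ⊏ b
  cover⊎between {a} {b} (a⊑b , a≢b)
    with any? (λ c → <-decidable _≟_ _⊑?_ a c ×-dec <-decidable _≟_ _⊑?_ c b)
  ... | yes between = inj₂ between
  ... | no ¬between = inj₁ (a⊑b , a≢b , ends)
    where
    ends : ∀ c → a ⊑ c → c ⊑ b → c ≡ a ⊎ c ≡ b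
    ends c a⊑c c⊑b with c ≟ a | c ≟ b
    ... | yes c≡a | _ = inj₁ c≡a
    ... | no _ | yes c≡b = inj₂ c≡b
    ... | no c≢a | no c≢b = ⊥-elim (¬between (c , (a⊑c , c≢a ∘ sym) , (c⊑b , c≢b)))

  upper-cover-below : ∀ {a b} → Acc _⊏_ b → a ⊏ b → ∃ λ c → Covers _≡_ _⊑_ a c × c ⊑ b
  upper-cover-below (acc rec) a⊏b with cover⊎between a⊏b
  ... | inj₁ a⋖b = _ , a⋖b , ⊑-refl
  ... | inj₂ (c , a⊏c , c⊏b) =
    let d , a⋖d , d⊑c = upper-cover-below (rec c⊏b) a⊏c in d , a⋖d , ⊑-trans d⊑c (proj₁ c⊏b)

  ρ-strict-acc : ∀ {a b} → Acc (flip _⊏_) a → a ⊏ b → ρ a < ρ b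
  ρ-strict-acc {a} {b} (acc rec) a⊏b with upper-cover-below (po-wellFounded isPartialOrder b) a⊏b
  ... | c , a⋖c@(a⊑c , a≢c , _) , c⊑b with c ≟ b
  ...   | yes refl = ≤-reflexive (sym (ρ-cover a c a⋖c))
  ...   | no c≢b =
    <-trans (≤-reflexive (sym (ρ-cover a c a⋖c))) (ρ-strict-acc (rec (a⊑c , a≢c)) (c⊑b , c≢b))

  ρ-strict : ∀ {a b} → a ⊏ b → ρ a < ρ b
  ρ-strict {a} = ρ-strict-acc (po-noetherian isPartialOrder a)

  ρ-mono : ∀ {a b} → a ⊑ b → ρ a ≤ ρ b
  ρ-mono {a} {b} a⊑b with a ≟ b
  ... | yes refl = ≤-refl
  ... | no a≢b = <⇒≤ (ρ-strict (a⊑b , a≢b))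

module SemimodularLatticeProperties {m : ℕ} {_⊑_ : Rel (Fin m) 0ℓ}
  (L : IsSemimodularLattice _≡_ _⊑_) where

  open IsSemimodularLattice L public
  open IsPartialOrder isPartialOrder public
    using () renaming (refl to ⊑-refl; trans to ⊑-trans; antisym to ⊑-antisym)

  x⊑x∨y : ∀ a b → a ⊑ (a ∨ b)
  x⊑x∨y a b = proj₁ (∨-isJoin a b)

  y⊑x∨y : ∀ a b → b ⊑ (a ∨ b)
  y⊑x∨y a b = proj₁ (proj₂ (∨-isJoin a b))

  ∨-least : ∀ {a b c} → a ⊑ c → b ⊑ c → (a ∨ b) ⊑ c
  ∨-least {a} {b} {c} = proj₂ (proj₂ (∨-isJoin a b)) c

  x∧y⊑x : ∀ a b → (a ∧ b) ⊑ a
  x∧y⊑x a b = proj₁ (∧-isMeet a b)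

  x∧y⊑y : ∀ a b → (a ∧ b) ⊑ b
  x∧y⊑y a b = proj₁ (proj₂ (∧-isMeet a b))

  ∧-greatest : ∀ {a b c} → c ⊑ a → c ⊑ b → c ⊑ (a ∧ b)
  ∧-greatest {a} {b} {c} = proj₂ (proj₂ (∧-isMeet a b)) c

  _⊑?_ : Decidable _⊑_
  a ⊑? b = map′ (λ a∨b≡b → subst (a ⊑_) a∨b≡b (x⊑x∨y a b))
                (λ a⊑b → ⊑-antisym (∨-least a⊑b ⊑-refl) (y⊑x∨y a b))
                ((a ∨ b) ≟ᶠ b)

  isDecPartialOrder : IsDecPartialOrder _≡_ _⊑_
  isDecPartialOrder = record { isPartialOrder = isPartialOrder ; _≟_ = _≟ᶠ_ ; _≤?_ = _⊑?_ }

  open FiniteGradedPoset isDecPartialOrder ρ ρ-cover public using (ρ-strict; ρ-mono)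

  ρ-∧-modular-cover : ∀ {p p′} → IsModular _≡_ _⊑_ L p → IsModular _≡_ _⊑_ L p′ →
                      Covers _≡_ _⊑_ p p′ → ∀ z → ρ (p′ ∧ z) ≤ suc (ρ (p ∧ z))
  ρ-∧-modular-cover {p} {p′} p-mod p′-mod p⋖p′@(p⊑p′ , _) z = +-cancelˡ-≤ (ρ (p′ ∨ z)) _ _ (begin
    ρ (p′ ∨ z) + ρ (p′ ∧ z)       ≡⟨ sym (p′-mod z) ⟩
    ρ p′ + ρ z                    ≡⟨ cong (_+ ρ z) (ρ-cover p p′ p⋖p′) ⟩
    suc (ρ p + ρ z)               ≡⟨ cong suc (p-mod z) ⟩
    suc (ρ (p ∨ z) + ρ (p ∧ z))   ≤⟨ s≤s (+-monoˡ-≤ _ (ρ-mono p∨z⊑p′∨z)) ⟩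
    suc (ρ (p′ ∨ z) + ρ (p ∧ z))  ≡⟨ sym (+-suc _ _) ⟩
    ρ (p′ ∨ z) + suc (ρ (p ∧ z))  ∎)
    where
    open ≤-Reasoning
    p∨z⊑p′∨z : (p ∨ z) ⊑ (p′ ∨ z)
    p∨z⊑p′∨z = ∨-least (⊑-trans p⊑p′ (x⊑x∨y p′ z)) (y⊑x∨y p′ z)

  ρ-∨-≤ : ∀ {y a b} → b ⊑ y → b ⊑ a → ρ a ≤ suc (ρ b) → ρ (y ∨ a) ≤ suc (ρ y)
  ρ-∨-≤ {y} {a} {b} b⊑y b⊑a ρa≤1+ρb = +-cancelʳ-≤ (ρ (y ∧ a)) _ _ (begin
    ρ (y ∨ a) + ρ (y ∧ a)   ≤⟨ semimodular y a ⟩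
    ρ y + ρ a               ≤⟨ +-monoʳ-≤ (ρ y) ρa≤1+ρb ⟩
    ρ y + suc (ρ b)         ≤⟨ +-monoʳ-≤ (ρ y) (s≤s (ρ-mono (∧-greatest b⊑y b⊑a))) ⟩
    ρ y + suc (ρ (y ∧ a))   ≡⟨ +-suc _ _ ⟩
    suc (ρ y) + ρ (y ∧ a)   ∎)
    where open ≤-Reasoning

  module MeetsIn {P : Fin m → Set} (P? : ∀ a → Dec (P a)) (P-bot : P bot)
                 (P-∨ : ∀ {a b} → P a → P b → P (a ∨ b)) where

    join-of-lower-bounds : ∀ y z {N} (f : Fin N → Fin m) → ∃ λ u → P u × u ⊑ y × u ⊑ z ×
                           (∀ i → P (f i) → f i ⊑ y → f i ⊑ z → f i ⊑ u)
    join-of-lower-bounds y z {zero} f = bot , P-bot , bot-least y , bot-least z , λ ()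
    join-of-lower-bounds y z {suc N} f with join-of-lower-bounds y z (f ∘ suc)
                                          | P? (f zero) ×-dec (f zero ⊑? y) ×-dec (f zero ⊑? z)
    ... | u , Pu , u⊑y , u⊑z , u-ub | yes (Pf0 , f0⊑y , f0⊑z) =
      f zero ∨ u , P-∨ Pf0 Pu , ∨-least f0⊑y u⊑y , ∨-least f0⊑z u⊑z ,
      λ { zero _ _ _ → x⊑x∨y _ _ ; (suc i) Pfi fi⊑y fi⊑z → ⊑-trans (u-ub i Pfi fi⊑y fi⊑z) (y⊑x∨y _ _) }
    ... | u , Pu , u⊑y , u⊑z , u-ub | no ¬lb =
      u , Pu , u⊑y , u⊑z ,
      λ { zero Pf0 f0⊑y f0⊑z → ⊥-elim (¬lb (Pf0 , f0⊑y , f0⊑z)) ; (suc i) → u-ub i }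

    meet : ∀ (a b : Σ (Fin m) P) → Σ (Σ (Fin m) P) (IsMeet (SubEq P) (Induced P _⊑_) a b)
    meet (y , _) (z , _) =
      let u , Pu , u⊑y , u⊑z , u-ub = join-of-lower-bounds y z (λ i → i) in
      (u , Pu) , u⊑y , u⊑z , λ (w , Pw) → u-ub w Pw

    meet⊑∧ : ∀ a b → proj₁ (proj₁ (meet a b)) ⊑ (proj₁ a ∧ proj₁ b)
    meet⊑∧ a b = let _ , u⊑a , u⊑b , _ = meet a b in ∧-greatest u⊑a u⊑b

    meet≡∧ : ∀ a b → P (proj₁ a ∧ proj₁ b) → proj₁ (proj₁ (meet a b)) ≡ proj₁ a ∧ proj₁ b
    meet≡∧ a b P[a∧b] = let _ , _ , _ , u-greatest = meet a b in
      ⊑-antisym (meet⊑∧ a b) (u-greatest (_ , P[a∧b]) (x∧y⊑x _ _) (x∧y⊑y _ _))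

module MaximalChainProperties {m n : ℕ} {_⊑_ : Rel (Fin m) 0ℓ} (L : IsSemimodularLattice _≡_ _⊑_)
  (x : Fin (suc n) → Fin m) (chain : IsMaximalChain _≡_ _⊑_ n x) where

  open SemimodularLatticeProperties L

  x-least : ∀ a → x zero ⊑ a
  x-least = proj₁ chain

  x-greatest : ∀ a → a ⊑ x (fromℕ n)
  x-greatest = proj₁ (proj₂ chain)

  x-cover : ∀ i → Covers _≡_ _⊑_ (x (inject₁ i)) (x (suc i))
  x-cover = proj₂ (proj₂ chain)

  ρ∘x : ∀ i → ρ (x i) ≡ toℕ i
  ρ∘x = <-weakInduction (λ i → ρ (x i) ≡ toℕ i) ρ[x₀]≡0 λ i ρ[xᵢ]≡i →
    trans (ρ-cover _ _ (x-cover i)) (cong suc (trans ρ[xᵢ]≡i (toℕ-inject₁ i)))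
    where
    ρ[x₀]≡0 : ρ (x zero) ≡ 0
    ρ[x₀]≡0 = trans (cong ρ (⊑-antisym (x-least bot) (bot-least _))) ρ-bot

  x-mono : ∀ {i j} → toℕ i ≤ toℕ j → x i ⊑ x j
  x-mono {i} = <-weakInduction-startingFrom (λ j → x i ⊑ x j) ⊑-refl
                 λ j xᵢ⊑xⱼ → ⊑-trans xᵢ⊑xⱼ (proj₁ (x-cover j))

  x-mono⁻¹ : ∀ {i j} → x i ⊑ x j → toℕ i ≤ toℕ j
  x-mono⁻¹ {i} {j} xᵢ⊑xⱼ = subst₂ _≤_ (ρ∘x i) (ρ∘x j) (ρ-mono xᵢ⊑xⱼ)

module Truncation {m n : ℕ} {_⊑_ : Rel (Fin m) 0ℓ} (L : IsSemimodularLattice _≡_ _⊑_)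
  (x : Fin (suc n) → Fin m) (chain : IsMaximalChain _≡_ _⊑_ n x)
  (x-modular : ∀ i → IsModular _≡_ _⊑_ L (x i)) (k : ℕ) (1≤k : 1 ≤ k) where

  open SemimodularLatticeProperties L
  open MaximalChainProperties L x chain

  Lᵏ : Fin m → Set
  Lᵏ = InLk _⊑_ L x k

  _≈ₖ_ _⊑ₖ_ : Rel (Σ (Fin m) Lᵏ) 0ℓ
  _≈ₖ_ = SubEq Lᵏ
  _⊑ₖ_ = Induced Lᵏ _⊑_

  ∈Lᵏ : ∀ {y i} → y ⊑ x i → toℕ i < k + ρ y → Lᵏ y
  ∈Lᵏ {y} y⊑xᵢ i<k+ρy =
    let j , y⊑xⱼ , j-least = ∃-least (λ j → y ⊑? x j) y⊑xᵢ in
    j , (y⊑xⱼ , j-least) , ≤-<-trans (j-least _ y⊑xᵢ) i<k+ρy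

  Lᵏ? : ∀ y → Dec (Lᵏ y)
  Lᵏ? y = map′ (λ (_ , y⊑xᵢ , i<k+ρy) → ∈Lᵏ y⊑xᵢ i<k+ρy)
               (λ (i , (y⊑xᵢ , _) , i<k+ρy) → i , y⊑xᵢ , i<k+ρy)
               (any? λ i → (y ⊑? x i) ×-dec (toℕ i <? k + ρ y))

  <k+ρ-mono : ∀ {i y y′} → y ⊑ y′ → i < k + ρ y → i < k + ρ y′
  <k+ρ-mono y⊑y′ i<k+ρy = <-≤-trans i<k+ρy (+-monoʳ-≤ k (ρ-mono y⊑y′))

  x∈Lᵏ : ∀ i → Lᵏ (x i)
  x∈Lᵏ i = i , (⊑-refl , λ _ → x-mono⁻¹) ,
           subst (λ r → toℕ i < k + r) (sym (ρ∘x i)) (+-monoˡ-≤ (toℕ i) 1≤k)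

  bot∈Lᵏ : Lᵏ bot
  bot∈Lᵏ = ∈Lᵏ {i = zero} (bot-least (x zero)) (≤-trans 1≤k (m≤m+n k _))

  ∨∈Lᵏ : ∀ {y z} → Lᵏ y → Lᵏ z → Lᵏ (y ∨ z)
  ∨∈Lᵏ {y} {z} (i , (y⊑xᵢ , _) , i<k+ρy) (j , (z⊑xⱼ , _) , j<k+ρz) with ≤-total (toℕ i) (toℕ j)
  ... | inj₁ i≤j = ∈Lᵏ (∨-least (⊑-trans y⊑xᵢ (x-mono i≤j)) z⊑xⱼ) (<k+ρ-mono (y⊑x∨y y z) j<k+ρz)
  ... | inj₂ j≤i = ∈Lᵏ (∨-least y⊑xᵢ (⊑-trans z⊑xⱼ (x-mono j≤i))) (<k+ρ-mono (x⊑x∨y y z) i<k+ρy)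

  <k+ρ[x∧] : ∀ {y i l} → y ⊑ x l → toℕ l < k + ρ y → toℕ i ≤ toℕ l → toℕ i < k + ρ (x i ∧ y)
  <k+ρ[x∧] {y} {i} {l} y⊑xₗ l<k+ρy i≤l = +-cancelʳ-< (ρ y) _ _ (begin-strict
    toℕ i + ρ y                 ≡⟨ cong (_+ ρ y) (sym (ρ∘x i)) ⟩
    ρ (x i) + ρ y               ≡⟨ x-modular i y ⟩
    ρ (x i ∨ y) + ρ (x i ∧ y)   ≤⟨ +-monoˡ-≤ _ (subst (ρ (x i ∨ y) ≤_) (ρ∘x l) (ρ-mono xᵢ∨y⊑xₗ)) ⟩
    toℕ l + ρ (x i ∧ y)         <⟨ +-monoˡ-< _ l<k+ρy ⟩
    k + ρ y + ρ (x i ∧ y)       ≡⟨ xy∙z≈xz∙y k _ _ ⟩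
    k + ρ (x i ∧ y) + ρ y       ∎)
    where
    open ≤-Reasoning
    xᵢ∨y⊑xₗ : (x i ∨ y) ⊑ x l
    xᵢ∨y⊑xₗ = ∨-least (x-mono i≤l) y⊑xₗ

  x∧∈Lᵏ : ∀ i {y} → Lᵏ y → Lᵏ (x i ∧ y)
  x∧∈Lᵏ i {y} (l , (y⊑xₗ , _) , l<k+ρy) with ≤-total (toℕ i) (toℕ l)
  ... | inj₁ i≤l = ∈Lᵏ (x∧y⊑x (x i) y) (<k+ρ[x∧] y⊑xₗ l<k+ρy i≤l)
  ... | inj₂ l≤i = ∈Lᵏ (⊑-trans (x∧y⊑y (x i) y) y⊑xₗ)
                       (<k+ρ-mono (∧-greatest (⊑-trans y⊑xₗ (x-mono l≤i)) ⊑-refl) l<k+ρy)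

  open MeetsIn Lᵏ? bot∈Lᵏ ∨∈Lᵏ using (meet; meet⊑∧; meet≡∧)

  climb : Fin m → Fin m → Fin n → Fin m
  climb y z i = y ∨ (x (suc i) ∧ z)

  ρ-climb : ∀ {y z} i → (x (inject₁ i) ∧ z) ⊑ y → ¬ (x (suc i) ∧ z) ⊑ y →
            ρ (climb y z i) ≡ suc (ρ y)
  ρ-climb {y} {z} i xᵢ∧z⊑y xᵢ₊₁∧z⋢y = ≤-antisym
    (ρ-∨-≤ xᵢ∧z⊑y xᵢ∧z⊑xᵢ₊₁∧z (ρ-∧-modular-cover (x-modular _) (x-modular _) (x-cover i) z))
    (ρ-strict (x⊑x∨y _ _ , λ y≡climb → xᵢ₊₁∧z⋢y (subst (_ ⊑_) (sym y≡climb) (y⊑x∨y _ _))))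
    where
    xᵢ∧z⊑xᵢ₊₁∧z : (x (inject₁ i) ∧ z) ⊑ (x (suc i) ∧ z)
    xᵢ∧z⊑xᵢ₊₁∧z = ∧-greatest (⊑-trans (x∧y⊑x _ z) (proj₁ (x-cover i))) (x∧y⊑y _ z)

  climb∈Lᵏ : ∀ {y z} i → Lᵏ y → Lᵏ z → y ⊑ z → y ≢ z →
             (x (inject₁ i) ∧ z) ⊑ y → ¬ (x (suc i) ∧ z) ⊑ y → Lᵏ (climb y z i)
  climb∈Lᵏ {y} {z} i (l , (y⊑xₗ , _) , l<k+ρy) (l′ , (z⊑xₗ′ , _) , l′<k+ρz) y⊑z y≢z xᵢ∧z⊑y xᵢ₊₁∧z⋢y
    with ≤inject₁⊎suc≤ (toℕ l) i
  ... | inj₂ i+1≤l =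
    ∈Lᵏ (∨-least y⊑xₗ (⊑-trans (x∧y⊑x _ z) (x-mono i+1≤l))) (<k+ρ-mono (x⊑x∨y _ _) l<k+ρy)
  -- Here xᵢ ∧ z = y, and z ⋢ xᵢ forces ν z ≥ i, so modularity of xᵢ bounds i by k + ρ y.
  ... | inj₁ l≤i = ∈Lᵏ (∨-least (⊑-trans y⊑xᵢ (proj₁ (x-cover i))) (x∧y⊑x _ z)) (begin-strict
    suc (toℕ i)                        ≡⟨ cong suc (sym (toℕ-inject₁ i)) ⟩
    suc (toℕ (inject₁ i))              <⟨ s≤s (<k+ρ[x∧] z⊑xₗ′ l′<k+ρz i≤l′) ⟩
    suc (k + ρ (x (inject₁ i) ∧ z))    ≡⟨ cong (λ t → suc (k + ρ t)) xᵢ∧z≡y ⟩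
    suc (k + ρ y)                      ≡⟨ sym (+-suc k (ρ y)) ⟩
    k + suc (ρ y)                      ≡⟨ cong (k +_) (sym (ρ-climb i xᵢ∧z⊑y xᵢ₊₁∧z⋢y)) ⟩
    k + ρ (climb y z i)                ∎)
    where
    open ≤-Reasoning
    y⊑xᵢ : y ⊑ x (inject₁ i)
    y⊑xᵢ = ⊑-trans y⊑xₗ (x-mono l≤i)
    xᵢ∧z≡y : x (inject₁ i) ∧ z ≡ y
    xᵢ∧z≡y = ⊑-antisym xᵢ∧z⊑y (∧-greatest y⊑xᵢ y⊑z)
    i≤l′ : toℕ (inject₁ i) ≤ toℕ l′
    i≤l′ with ≤-total (toℕ (inject₁ i)) (toℕ l′)
    ... | inj₁ i≤l′ = i≤l′
    ... | inj₂ l′≤i = ⊥-elim (y≢z (⊑-antisym y⊑z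
            (subst (z ⊑_) xᵢ∧z≡y (∧-greatest (⊑-trans z⊑xₗ′ (x-mono l′≤i)) ⊑-refl))))

  xₙ∧z⋢y : ∀ {y z} → y ⊑ z → y ≢ z → ¬ (x (fromℕ n) ∧ z) ⊑ y
  xₙ∧z⋢y y⊑z y≢z xₙ∧z⊑y = y≢z (⊑-antisym y⊑z (⊑-trans (∧-greatest (x-greatest _) ⊑-refl) xₙ∧z⊑y))

  ρ-coverₖ : ∀ a b → Covers _≈ₖ_ _⊑ₖ_ a b → ρ (proj₁ b) ≡ suc (ρ (proj₁ a))
  ρ-coverₖ (y , y∈) (z , z∈) (y⊑z , y≢z , y⋖z)
    with crossing (λ j → (x j ∧ z) ⊑? y) (⊑-trans (x∧y⊑x _ z) (x-least y)) (xₙ∧z⋢y y⊑z y≢z)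
  ... | i , xᵢ∧z⊑y , xᵢ₊₁∧z⋢y
    with y⋖z (climb y z i , climb∈Lᵏ i y∈ z∈ y⊑z y≢z xᵢ∧z⊑y xᵢ₊₁∧z⋢y)
             (x⊑x∨y _ _) (∨-least y⊑z (x∧y⊑y _ z))
  ... | inj₁ climb≡y = ⊥-elim (xᵢ₊₁∧z⋢y (subst (_ ⊑_) climb≡y (y⊑x∨y _ _)))
  ... | inj₂ climb≡z = trans (cong ρ (sym climb≡z)) (ρ-climb i xᵢ∧z⊑y xᵢ₊₁∧z⋢y)

  Lᵏ-semimodularLattice : IsSemimodularLattice _≈ₖ_ _⊑ₖ_
  Lᵏ-semimodularLattice = record
    { isPartialOrder = On.isPartialOrder proj₁ isPartialOrder
    ; _∨_            = λ (y , y∈) (z , z∈) → y ∨ z , ∨∈Lᵏ y∈ z∈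
    ; _∧_            = λ a b → proj₁ (meet a b)
    ; ∨-isJoin       = λ _ _ → x⊑x∨y _ _ , y⊑x∨y _ _ , λ _ → ∨-least
    ; ∧-isMeet       = λ a b → proj₂ (meet a b)
    ; bot            = bot , bot∈Lᵏ
    ; bot-least      = bot-least ∘ proj₁
    ; ρ              = ρ ∘ proj₁
    ; ρ-resp         = λ _ _ → cong ρ
    ; ρ-bot          = ρ-bot
    ; ρ-cover        = ρ-coverₖ
    ; semimodular    = λ a b → ≤-trans (+-monoʳ-≤ _ (ρ-mono (meet⊑∧ a b))) (semimodular _ _)
    }

  chainₖ : IsMaximalChain _≈ₖ_ _⊑ₖ_ n (λ i → x i , x∈Lᵏ i)
  chainₖ = x-least ∘ proj₁ , x-greatest ∘ proj₁ , λ i →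
    let xᵢ⊑xᵢ₊₁ , xᵢ≢xᵢ₊₁ , nothing-between = x-cover i in
    xᵢ⊑xᵢ₊₁ , xᵢ≢xᵢ₊₁ , nothing-between ∘ proj₁

  x-modularₖ : ∀ i → IsModular _≈ₖ_ _⊑ₖ_ Lᵏ-semimodularLattice (x i , x∈Lᵏ i)
  x-modularₖ i (y , y∈) =
    trans (x-modular i y)
          (cong (λ t → ρ (x i ∨ y) + ρ t) (sym (meet≡∧ (x i , x∈Lᵏ i) (y , y∈) (x∧∈Lᵏ i y∈))))

lemma3p5 : (m n : ℕ) (_⊑_ : Rel (Fin m) 0ℓ) (L : IsSemimodularLattice _≡_ _⊑_)
           (x : Fin (suc n) → Fin m) →
           IsMaximalChain _≡_ _⊑_ n x → (∀ i → IsModular _≡_ _⊑_ L (x i)) →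
           (k : ℕ) → 1 ≤ k →
           Σ (∀ i → InLk _⊑_ L x k (x i)) λ mem →
           Σ (IsSemimodularLattice (SubEq (InLk _⊑_ L x k)) (Induced (InLk _⊑_ L x k) _⊑_)) λ Lk →
             IsSupersolvable (SubEq (InLk _⊑_ L x k)) (Induced (InLk _⊑_ L x k) _⊑_) Lk
             × IsMaximalChain (SubEq (InLk _⊑_ L x k)) (Induced (InLk _⊑_ L x k) _⊑_) n (λ i → x i , mem i)
             × (∀ i → IsModular (SubEq (InLk _⊑_ L x k)) (Induced (InLk _⊑_ L x k) _⊑_) Lk (x i , mem i))
lemma3p5 m n _⊑_ L x chain x-modular k 1≤k =
  x∈Lᵏ , Lᵏ-semimodularLattice , (n , (λ i → x i , x∈Lᵏ i) , chainₖ , x-modularₖ) , chainₖ , x-modularₖ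
  where open Truncation L x chain x-modular k 1≤k
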